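{- Let $(X,\nu,\mathcal{T},\tau)$ be a Type 1 computable topological space that satisfies the Markov condition with respect to effective closure (for all $x\in X$, $A\subseteq X$ with $x\notin A$ and $x\in\overline{A}^{+}$, $\{x\}$ is not a $\nu$-semi-decidable subset of $A\cup\{x\}$). Suppose that $\overline{C}=\overline{C}^{+}$ for every $\nu$-co-semi-decidable subset $C$ of $X$. Then $\mathcal{T}$ is the topology on $X$ generated by the $\nu$-semi-decidable sets.
   Context: A numbering of a set $X$ is a surjection $\nu$ from a subset $\mathrm{dom}(\nu)\subseteq\mathbb{N}$ onto $X$; a subnumbering of $X$ is a numbering of a subset of $X$. $\varphi_0,\varphi_1,\dots$ is a standard enumeration of partial recursive functions. A set $A\subseteq X$ is $\nu$-semi-decidable if there is $e$ with $\varphi_e(i)\downarrow\iff\nu(i)\in A$ for all $i\in\mathrm{dom}(\nu)$; such $e$ is a $\nu_{SD}$-name of $A$; $A$ is $\nu$-co-semi-decidable if its complement is $\nu$-semi-decidable. For $B\subseteq C\subseteq X$, $B$ is a $\nu$-semi-decidable subset of $C$ if there is $e$ with, for all $i\in\mathrm{dom}(\nu)$ with $\nu(i)\in C$, $\varphi_e(i)\downarrow\iff\nu(i)\in B$. For subnumberings $\alpha,\beta$, $\alpha\le\beta$ means there is a partial computable $F$ defined on $\mathrm{dom}(\alpha)$ with $\beta(F(n))=\alpha(n)$. A Type 1 computable topological space is a quadruple $(X,\nu,\mathcal{T},\tau)$ where $\mathcal{T}$ is a topology on $X$, $\nu$ a numbering of $X$, $\tau$ a subnumbering of $\mathcal{T}$,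 such that: the image of $\tau$ generates $\mathcal{T}$ as a basis; $\emptyset$ and $X$ are in the image of $\tau$; $\tau\le\nu_{SD}$; there is a computable procedure which, given an index of a total computable $g$ with values in $\mathrm{dom}(\tau)$, outputs a $\tau$-name of $\bigcup_n\tau(g(n))$; and there is a computable procedure which from $\tau$-names of $O_1,O_2$ outputs a $\tau$-name of $O_1\cap O_2$. $\overline{C}$ is the closure in $\mathcal{T}$; $x\in\overline{C}^{+}$ iff there is a partial computable function which, on any $\tau$-name of an open set $O$ containing $x$, outputs a $\nu$-name of a point of $O\cap C$. -}

module Defs where

open import Level using (0ℓ)
open import Data.Nat using (ℕ; zero; suc; _+_; _<_; _≟_)
open import Data.Product using (Σ; ∃; _×_; _,_; proj₁; proj₂)
open import Data.Sum using (_⊎_)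
open import Data.Unit using (⊤)
open import Data.Empty using (⊥)
open import Relation.Nullary using (¬_; yes; no)
open import Relation.Binary.PropositionalEquality using (_≡_)
open import Relation.Unary using (Pred; _⊆_; _≐_; _∩_)
open import Function using (_⇔_)

-- A concrete standard enumeration φ₀, φ₁, … of the partial recursive
-- functions ℕ ⇀ ℕ (unary μ-recursive functions with Cantor pairing).

tri : ℕ → ℕ
tri zero    = 0
tri (suc n) = suc n + tri n

pair : ℕ → ℕ → ℕ
pair x y = tri (x + y) + y

-- inverse of the Cantor pairing (enumerating diagonals)
unpair : ℕ → ℕ × ℕ
unpair zero = 0 , 0
unpair (suc n) with unpair n
... | zero  , y = suc y , 0
... | suc x , y = x , suc y

fst snd : ℕ → ℕ
fst n = proj₁ (unpair n)
snd n = proj₂ (unpair n)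

data Code : Set where
  zeroC succC idC fstC sndC : Code
  compC  : Code → Code → Code
  pairC  : Code → Code → Code
  precC  : Code → Code → Code          -- primitive recursion on ⟨x , n⟩
  muC    : Code → Code                 -- x ↦ μ n. f ⟨x , n⟩ = 0

mutual
  data Eval : Code → ℕ → ℕ → Set where
    ev-zero : ∀ {x} → Eval zeroC x 0
    ev-succ : ∀ {x} → Eval succC x (suc x)
    ev-id   : ∀ {x} → Eval idC x x
    ev-fst  : ∀ {x} → Eval fstC x (fst x)
    ev-snd  : ∀ {x} → Eval sndC x (snd x)
    ev-comp : ∀ {f g x y z} → Eval g x y → Eval f y z → Eval (compC f g) x z
    ev-pair : ∀ {f g x a b} → Eval f x a → Eval g x b → Eval (pairC f g) x (pair a b)
    ev-prec : ∀ {f g z v} → PRec f g (fst z) (snd z) v → Eval (precC f g) z v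
    ev-mu   : ∀ {f x n} → Eval f (pair x n) 0 →
              (∀ m → m < n → Σ ℕ λ k → Eval f (pair x m) (suc k)) →
              Eval (muC f) x n

  data PRec (f g : Code) (x : ℕ) : ℕ → ℕ → Set where
    pr-zero : ∀ {v} → Eval f x v → PRec f g x 0 v
    pr-suc  : ∀ {n w v} → PRec f g x n w → Eval g (pair x (pair n w)) v →
              PRec f g x (suc n) v

-- Gödel numbering: e = ⟨tag , rest⟩ (fuel argument for termination)
decode′ : ℕ → ℕ → Code
decode′ zero    e = zeroC
decode′ (suc k) e with unpair e
... | 0 , r = zeroC
... | 1 , r = succC
... | 2 , r = idC
... | 3 , r = fstC
... | 4 , r = sndC
... | 5 , r = compC (decode′ k (fst r)) (decode′ k (snd r))
... | 6 , r = pairC (decode′ k (fst r)) (decode′ k (snd r))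
... | 7 , r = precC (decode′ k (fst r)) (decode′ k (snd r))
... | 8 , r = muC (decode′ k r)
... | _ , r = zeroC

decode : ℕ → Code
decode e = decode′ e e

_·_↓_ : ℕ → ℕ → ℕ → Set
e · x ↓ v = Eval (decode e) x v

_·_↓ : ℕ → ℕ → Set
e · x ↓ = Σ ℕ λ v → e · x ↓ v

⋃ : {X : Set} {I : Set} → (I → Pred X 0ℓ) → Pred X 0ℓ
⋃ {I = I} F x = Σ I λ i → F i x

record IsTopology {X : Set} (𝒯 : Pred (Pred X 0ℓ) (Level.suc 0ℓ)) : Set₁ where
  field
    open-resp  : ∀ {U V : Pred X 0ℓ} → U ≐ V → 𝒯 U → 𝒯 V
    open-univ  : 𝒯 (λ _ → ⊤)
    open-inter : ∀ {U V : Pred X 0ℓ} → 𝒯 U → 𝒯 V → 𝒯 (U ∩ V)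
    open-union : ∀ {I : Set} (F : I → Pred X 0ℓ) → (∀ i → 𝒯 (F i)) → 𝒯 (⋃ F)

data GenTop {X : Set} (ℬ : Pred (Pred X 0ℓ) 0ℓ) : Pred (Pred X 0ℓ) (Level.suc 0ℓ) where
  gen-base  : ∀ {A} → ℬ A → GenTop ℬ A
  gen-resp  : ∀ {U V} → U ≐ V → GenTop ℬ U → GenTop ℬ V
  gen-univ  : GenTop ℬ (λ _ → ⊤)
  gen-inter : ∀ {U V} → GenTop ℬ U → GenTop ℬ V → GenTop ℬ (U ∩ V)
  gen-union : ∀ {I : Set} (F : I → Pred X 0ℓ) → (∀ i → GenTop ℬ (F i)) → GenTop ℬ (⋃ F)

record Type1CTS : Set₂ where
  field
    -- the numbering ν : dom(ν) ⊆ ℕ ↠ X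
    X      : Set
    νdom   : Pred ℕ 0ℓ
    ν      : (i : ℕ) → .(νdom i) → X
    ν-surj : ∀ (x : X) → Σ ℕ λ i → Σ (νdom i) λ d → ν i d ≡ x
    𝒯      : Pred (Pred X 0ℓ) (Level.suc 0ℓ)
    𝒯-top  : IsTopology 𝒯
    τdom   : Pred ℕ 0ℓ
    τ      : (n : ℕ) → .(τdom n) → Pred X 0ℓ
    τ-open : ∀ n (d : τdom n) → 𝒯 (τ n d)

  SDName : ℕ → Pred X 0ℓ → Set
  SDName e A = ∀ i (d : νdom i) → (e · i ↓ ⇔ A (ν i d))

  SD : Pred (Pred X 0ℓ) 0ℓ
  SD A = Σ ℕ λ e → SDName e A

  field
    τ-basis : ∀ (U : Pred X 0ℓ) → 𝒯 U → ∀ x → U x →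
              Σ ℕ λ n → Σ (τdom n) λ d → τ n d x × τ n d ⊆ U
    τ-empty : Σ ℕ λ n → Σ (τdom n) λ d → τ n d ≐ (λ _ → ⊥)
    τ-univ  : Σ ℕ λ n → Σ (τdom n) λ d → τ n d ≐ (λ _ → ⊤)
    τ≤νSD   : Σ ℕ λ c → ∀ n (d : τdom n) →
              Σ ℕ λ m → c · n ↓ m × SDName m (τ n d)
    τ-union : Σ ℕ λ c → ∀ k →
              (∀ n → Σ ℕ λ v → k · n ↓ v × τdom v) →
              Σ ℕ λ m → c · k ↓ m × Σ (τdom m) λ dm →
                τ m dm ≐ (λ x → Σ ℕ λ n → Σ ℕ λ v → k · n ↓ v ×
                                 Σ (τdom v) λ dv → τ v dv x)
    τ-inter : Σ ℕ λ c → ∀ n₁ n₂ (d₁ : τdom n₁) (d₂ : τdom n₂) →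
              Σ ℕ λ m → c · pair n₁ n₂ ↓ m × Σ (τdom m) λ dm →
                τ m dm ≐ (τ n₁ d₁ ∩ τ n₂ d₂)

  CoSD : Pred (Pred X 0ℓ) 0ℓ
  CoSD C = SD (λ x → ¬ C x)

  SDSubsetOf : Pred X 0ℓ → Pred X 0ℓ → Set
  SDSubsetOf B C = Σ ℕ λ e → ∀ i (d : νdom i) → C (ν i d) →
                     (e · i ↓ ⇔ B (ν i d))

  closure : Pred X 0ℓ → Pred X (Level.suc 0ℓ)
  closure C x = ∀ (O : Pred X 0ℓ) → 𝒯 O → O x → Σ X λ y → O y × C y

  closure⁺ : Pred X 0ℓ → Pred X 0ℓ
  closure⁺ C x = Σ ℕ λ c → ∀ n (d : τdom n) → τ n d x →
                   Σ ℕ λ m → c · n ↓ m × Σ (νdom m) λ dm →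
                     τ n d (ν m dm) × C (ν m dm)

  MarkovCondition : Set₁
  MarkovCondition = ∀ (x : X) (A : Pred X 0ℓ) → ¬ A x → closure⁺ A x →
                      ¬ SDSubsetOf (λ y → y ≡ x) (λ y → A y ⊎ y ≡ x)

-- Every basic open set is ν-semi-decidable, so 𝒯 is contained in the topology generated by the
-- semi-decidable sets. Conversely, let A be semi-decidable and x ∈ A. If no basic neighbourhood
-- of x lies inside A, then x is in the closure of the co-semi-decidable set ∁ A, hence in its
-- effective closure; but a ν_SD-name of A decides {x} inside ∁ A ∪ {x}, against the Markov
-- condition. So every point of A is interior and A is open.
{-# OPTIONS --safe #-}
module Submission where

open import Defs
open import Level using (0ℓ)
open import Relation.Unary using (Pred; _≐_; _⊆_; ∁)
open import Function using (_⇔_; mk⇔; Equivalence)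
open import Axiom.ExcludedMiddle using (ExcludedMiddle)
open import Axiom.DoubleNegationElimination using (em⇒dne)
open import Data.Product using (Σ; _×_; _,_; proj₁; proj₂)
open import Data.Sum using (_⊎_; inj₁; inj₂)
open import Data.Nat using (ℕ)
open import Data.Empty using (⊥-elim)
open import Relation.Nullary using (¬_; yes; no)
open import Relation.Binary.PropositionalEquality using (_≡_; refl; subst; sym)

module _ (S : Type1CTS) where
  open Type1CTS S
  open IsTopology 𝒯-top
  open Equivalence

  BasicNbhdWithin : Pred X 0ℓ → X → Set
  BasicNbhdWithin U x = Σ ℕ λ n → Σ (τdom n) λ d → τ n d x × τ n d ⊆ U

  module _ {U : Pred X 0ℓ} (nbhd : ∀ x → U x → BasicNbhdWithin U x) where

    chosenNbhd : Σ X U → Pred X 0ℓ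
    chosenNbhd (x , ux) = let (n , d , _) = nbhd x ux in τ n d

    chosenNbhd-basic : ∀ i → Σ ℕ λ n → Σ (τdom n) λ d → chosenNbhd i ≡ τ n d
    chosenNbhd-basic (x , ux) = let (n , d , _) = nbhd x ux in n , d , refl

    ⋃-chosenNbhd : ⋃ chosenNbhd ≐ U
    ⋃-chosenNbhd = (λ { ((x , ux) , y∈) → proj₂ (proj₂ (proj₂ (nbhd x ux))) y∈ })
                 , (λ {y} uy → (y , uy) , proj₁ (proj₂ (proj₂ (nbhd y uy))))

  basic-SD : ∀ n (d : τdom n) → SD (τ n d)
  basic-SD n d = let (m , _ , name) = proj₂ τ≤νSD n d in m , name

  open⇒GenTop-SD : ∀ {U} → 𝒯 U → GenTop SD U
  open⇒GenTop-SD {U} oU =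
    gen-resp (⋃-chosenNbhd nbhd) (gen-union (chosenNbhd nbhd) isSD)
    where
      nbhd : ∀ x → U x → BasicNbhdWithin U x
      nbhd = τ-basis U oU
      isSD : ∀ i → GenTop SD (chosenNbhd nbhd i)
      isSD i with chosenNbhd-basic nbhd i
      ... | n , d , eq = subst (GenTop SD) (sym eq) (gen-base (basic-SD n d))

  SD⇒SDSubsetOf : ∀ {A B C : Pred X 0ℓ} → SD A → (∀ y → C y → (B y ⇔ A y)) → SDSubsetOf B C
  SD⇒SDSubsetOf (e , name) B⇔A = e , λ i d c →
    mk⇔ (λ h → from (B⇔A _ c) (to (name i d) h)) (λ b → from (name i d) (to (B⇔A _ c) b))

  module _ (lem : ExcludedMiddle 0ℓ) where

    dne : {P : Set} → ¬ ¬ P → P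
    dne = em⇒dne lem

    SD⇒CoSD-∁ : ∀ {A} → SD A → CoSD (∁ A)
    SD⇒CoSD-∁ (e , name) = e , λ i d →
      mk⇔ (λ h ¬a → ¬a (to (name i d) h)) (λ ¬¬a → from (name i d) (dne ¬¬a))

    ¬⊆⇒witness : ∀ {P Q : Pred X 0ℓ} → ¬ (P ⊆ Q) → Σ X λ y → P y × ¬ Q y
    ¬⊆⇒witness P⊈Q = dne λ ¬w → P⊈Q λ {y} Py → dne λ ¬Qy → ¬w (y , Py , ¬Qy)

    basicNbhdWithin-or-closure∁ : ∀ A x → BasicNbhdWithin A x ⊎ closure (∁ A) x
    basicNbhdWithin-or-closure∁ A x with lem {BasicNbhdWithin A x}
    ... | yes nbhd = inj₁ nbhd
    ... | no ¬nbhd = inj₂ meets∁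
      where
        meets∁ : closure (∁ A) x
        meets∁ O oO Ox with τ-basis O oO x Ox
        ... | n , d , τx , τ⊆O with ¬⊆⇒witness (λ τ⊆A → ¬nbhd (n , d , τx , τ⊆A))
        ...   | y , τy , ¬Ay = y , τ⊆O τy , ¬Ay

    module _ (markov : MarkovCondition)
             (closure≐closure⁺ : ∀ (C : Pred X 0ℓ) → CoSD C → closure C ≐ closure⁺ C) where

      SD-interior : ∀ {A} → SD A → ∀ x → A x → BasicNbhdWithin A x
      SD-interior {A} sdA x ax with basicNbhdWithin-or-closure∁ A x
      ... | inj₁ nbhd = nbhd
      ... | inj₂ x∈cl = ⊥-elim (markov x (∁ A) (λ ¬Ax → ¬Ax ax) x∈cl⁺ singleton-SD)
        where
          x∈cl⁺ : closure⁺ (∁ A) x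
          x∈cl⁺ = proj₁ (closure≐closure⁺ (∁ A) (SD⇒CoSD-∁ {A} sdA)) x∈cl
          singleton-SD : SDSubsetOf (λ y → y ≡ x) (λ y → ∁ A y ⊎ y ≡ x)
          singleton-SD =
            SD⇒SDSubsetOf {A} {λ y → y ≡ x} {λ y → ∁ A y ⊎ y ≡ x} sdA λ where
              y (inj₁ ¬Ay) → mk⇔ (λ { refl → ax }) (λ Ay → ⊥-elim (¬Ay Ay))
              y (inj₂ refl) → mk⇔ (λ _ → ax) (λ _ → refl)

      SD⇒open : ∀ {A} → SD A → 𝒯 A
      SD⇒open {A} sdA = open-resp (⋃-chosenNbhd nbhd) (open-union (chosenNbhd nbhd) isOpen)
        where
          nbhd : ∀ x → A x → BasicNbhdWithin A x
          nbhd = SD-interior sdA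
          isOpen : ∀ i → 𝒯 (chosenNbhd nbhd i)
          isOpen i with chosenNbhd-basic nbhd i
          ... | n , d , eq = subst 𝒯 (sym eq) (τ-open n d)

      GenTop-SD⇒open : ∀ {U} → GenTop SD U → 𝒯 U
      GenTop-SD⇒open (gen-base s)    = SD⇒open s
      GenTop-SD⇒open (gen-resp eq g) = open-resp eq (GenTop-SD⇒open g)
      GenTop-SD⇒open gen-univ        = open-univ
      GenTop-SD⇒open (gen-inter g h) = open-inter (GenTop-SD⇒open g) (GenTop-SD⇒open h)
      GenTop-SD⇒open (gen-union F g) = open-union F (λ i → GenTop-SD⇒open (g i))

mainTheorem15 : ExcludedMiddle 0ℓ → (S : Type1CTS) →
    let open Type1CTS S in
    MarkovCondition →
    (∀ (C : Pred X 0ℓ) → CoSD C → closure C ≐ closure⁺ C) →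
    ∀ (U : Pred X 0ℓ) → 𝒯 U ⇔ GenTop SD U
mainTheorem15 lem S markov closure≐closure⁺ U =
  mk⇔ (open⇒GenTop-SD S) (GenTop-SD⇒open S lem markov closure≐closure⁺)
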